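{- For each $x\in\{\Box,\Diamond,\blacksquare,\bullet\}$, the logic $\mathbf{L}_x$ is sound with respect to the class of all $x$-PN-frames: every formula of $\mathbf{L}_x$ is forced at every world of every model based on an $x$-PN-frame.
   Context: For $x\in\{\Box,\Diamond,\blacksquare,\bullet\}$, the $x$-language has formulas built from a countable set $PV$ of propositional variables and $\bot$ by $\land,\lor,\rightarrow$ and the unary modal operator $x$; $\lnot\varphi$ abbreviates $\varphi\to\bot$, $\varphi\leftrightarrow\psi$ abbreviates $(\varphi\to\psi)\land(\psi\to\varphi)$. $\mathbf{L}_x$ is the smallest set of formulas containing all instances of the axiom schemes of intuitionistic propositional logic and all instances of $x\varphi\to\varphi$, closed under modus ponens and the rule: from $\varphi\leftrightarrow\psi$ infer $x\varphi\leftrightarrow x\psi$. For $X\subseteq W$ write $-X=W\setminus X$. An $x$-PN-frame is $\langle W,\mathcal{N},\leq\rangle$ with $\leq$ a partial order on $W$, $\mathcal{N}:W\to P(P(W))$ satisfying, for all $w,v\in W$, $X\subseteq W$ with $w\leq v$ and $v\in X$: (for $\Box$) $X\in\mathcal{N}_w\Rightarrow X\in\mathcal{N}_v$; (for $\Diamond$) $-X\notin\mathcal{N}_w\Rightarrow -X\notin\mathcal{N}_v$; (for $\blacksquare$) $-X\in\mathcal{N}_w\Rightarrow -X\in\mathcal{N}_v$; (for $\bullet$) $X\notin\mathcal{N}_w\Rightarrow X\notin\mathcal{N}_v$. A model adds $V:PV\to P(W)$ with each $V(q)$ upward closed. Forcing: $w\nVdash\bot$; $w\Vdash q$ iff $w\in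 V(q)$; $\land,\lor$ pointwise; $w\Vdash\varphi\to\psi$ iff for all $v\geq w$, $v\nVdash\varphi$ or $v\Vdash\psi$; with $V(\varphi)=\{z:z\Vdash\varphi\}$: $w\Vdash\Box\varphi$ iff $w\Vdash\varphi$ and $V(\varphi)\in\mathcal{N}_w$; $w\Vdash\Diamond\varphi$ iff $w\Vdash\varphi$ and $-V(\varphi)\notin\mathcal{N}_w$; $w\Vdash\blacksquare\varphi$ iff $w\Vdash\varphi$ and $-V(\varphi)\in\mathcal{N}_w$; $w\Vdash\bullet\varphi$ iff $w\Vdash\varphi$ and $V(\varphi)\notin\mathcal{N}_w$. -}

module Defs where

open import Data.Nat using (ℕ)
open import Data.Product using (_×_; _,_)
open import Data.Sum using (_⊎_)
open import Data.Empty using (⊥)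
open import Relation.Nullary using (¬_)
open import Relation.Binary.PropositionalEquality using (_≡_)
open import Relation.Binary.Structures using (IsPartialOrder)
open import Function.Bundles using (_⇔_)

data Mode : Set where
  box dia bbox bullet : Mode

-- Formulas of the x-language: the single unary modal constructor `md`
-- is interpreted as the operator x fixed by the Mode.
-- Propositional variables PV = ℕ (a countable set).
infixr 6 _∧'_
infixr 5 _∨'_
infixr 4 _⇒_
data Fm : Set where
  var  : ℕ → Fm
  ⊥'   : Fm
  _∧'_ : Fm → Fm → Fm
  _∨'_ : Fm → Fm → Fm
  _⇒_  : Fm → Fm → Fm
  md   : Fm → Fm

¬' : Fm → Fm
¬' φ = φ ⇒ ⊥'

_⇔'_ : Fm → Fm → Fm
φ ⇔' ψ = (φ ⇒ ψ) ∧' (ψ ⇒ φ)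

data Thm (x : Mode) : Fm → Set where
  ax-K   : ∀ φ ψ → Thm x (φ ⇒ (ψ ⇒ φ))
  ax-S   : ∀ φ ψ χ → Thm x ((φ ⇒ (ψ ⇒ χ)) ⇒ ((φ ⇒ ψ) ⇒ (φ ⇒ χ)))
  ax-∧E₁ : ∀ φ ψ → Thm x ((φ ∧' ψ) ⇒ φ)
  ax-∧E₂ : ∀ φ ψ → Thm x ((φ ∧' ψ) ⇒ ψ)
  ax-∧I  : ∀ φ ψ → Thm x (φ ⇒ (ψ ⇒ (φ ∧' ψ)))
  ax-∨I₁ : ∀ φ ψ → Thm x (φ ⇒ (φ ∨' ψ))
  ax-∨I₂ : ∀ φ ψ → Thm x (ψ ⇒ (φ ∨' ψ))
  ax-∨E  : ∀ φ ψ χ → Thm x ((φ ⇒ χ) ⇒ ((ψ ⇒ χ) ⇒ ((φ ∨' ψ) ⇒ χ)))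
  ax-⊥E  : ∀ φ → Thm x (⊥' ⇒ φ)
  ax-T   : ∀ φ → Thm x (md φ ⇒ φ)
  mp     : ∀ {φ ψ} → Thm x (φ ⇒ ψ) → Thm x φ → Thm x ψ
  cong-md : ∀ {φ ψ} → Thm x (φ ⇔' ψ) → Thm x (md φ ⇔' md ψ)

-- PN-frames. Subsets of W are predicates W → Set; since subsets are
-- sets, neighbourhoods are required to respect extensional equality.
record Frame : Set₁ where
  field
    W      : Set
    _≤_    : W → W → Set
    ≤-po   : IsPartialOrder _≡_ _≤_
    N      : W → (W → Set) → Set
    N-ext  : ∀ w (X Y : W → Set) → (∀ z → X z ⇔ Y z) → N w X → N w Y

compl : {W : Set} → (W → Set) → (W → Set)
compl X z = ¬ X z

PNCond : Mode → Frame → Set₁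
PNCond box F = let open Frame F in
  ∀ w v (X : W → Set) → w ≤ v → X v → N w X → N v X
PNCond dia F = let open Frame F in
  ∀ w v (X : W → Set) → w ≤ v → X v → ¬ N w (compl X) → ¬ N v (compl X)
PNCond bbox F = let open Frame F in
  ∀ w v (X : W → Set) → w ≤ v → X v → N w (compl X) → N v (compl X)
PNCond bullet F = let open Frame F in
  ∀ w v (X : W → Set) → w ≤ v → X v → ¬ N w X → ¬ N v X

record Model (F : Frame) : Set₁ where
  open Frame F
  field
    V     : ℕ → W → Set
    V-up  : ∀ q w v → w ≤ v → V q w → V q v

forces : (x : Mode) (F : Frame) → Model F → Frame.W F → Fm → Set
forces x F M w (var q)   = Model.V M q w
forces x F M w ⊥'        = ⊥
forces x F M w (φ ∧' ψ)  = forces x F M w φ × forces x F M w ψ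
forces x F M w (φ ∨' ψ)  = forces x F M w φ ⊎ forces x F M w ψ
forces x F M w (φ ⇒ ψ)   =
  ∀ v → Frame._≤_ F w v → forces x F M v φ → forces x F M v ψ
forces box F M w (md φ)    =
  forces box F M w φ × Frame.N F w (λ z → forces box F M z φ)
forces dia F M w (md φ)    =
  forces dia F M w φ × ¬ Frame.N F w (compl (λ z → forces dia F M z φ))
forces bbox F M w (md φ)   =
  forces bbox F M w φ × Frame.N F w (compl (λ z → forces bbox F M z φ))
forces bullet F M w (md φ) =
  forces bullet F M w φ × ¬ Frame.N F w (λ z → forces bullet F M z φ)

module Submission where

open import Defs
open import Data.Product using (_,_; proj₁; proj₂)
open import Data.Sum using (inj₁; inj₂)
open import Relation.Binary.Structures using (IsPartialOrder)
open import Function.Base using (_∘_)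
open import Function.Bundles using (mk⇔)

-- The intuitionistic axioms are valid because forcing is persistent along ≤;
-- for a modal formula md φ this is exactly the x-PN-frame condition, applied
-- to X = V(φ), which contains the later world by persistence of φ. The
-- congruence rule is sound because a valid φ ⇔ ψ makes V(φ) and V(ψ)
-- extensionally equal, and N respects extensional equality.

module _ (F : Frame) (M : Model F) where
  open Frame F

  md-persistent : ∀ x → PNCond x F → ∀ φ {w v} → w ≤ v → forces x F M v φ →
                  forces x F M w (md φ) → forces x F M v (md φ)
  md-persistent box    C φ {w} {v} w≤v v⊩φ (_ , nbhd) = v⊩φ , C w v _ w≤v v⊩φ nbhd
  md-persistent dia    C φ {w} {v} w≤v v⊩φ (_ , nbhd) = v⊩φ , C w v _ w≤v v⊩φ nbhd
  md-persistent bbox   C φ {w} {v} w≤v v⊩φ (_ , nbhd) = v⊩φ , C w v _ w≤v v⊩φ nbhd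
  md-persistent bullet C φ {w} {v} w≤v v⊩φ (_ , nbhd) = v⊩φ , C w v _ w≤v v⊩φ nbhd

  md-reflexive : ∀ x φ w → forces x F M w (md φ) → forces x F M w φ
  md-reflexive box    φ w = proj₁
  md-reflexive dia    φ w = proj₁
  md-reflexive bbox   φ w = proj₁
  md-reflexive bullet φ w = proj₁

  md-cong : ∀ x φ ψ → (∀ z → forces x F M z φ → forces x F M z ψ) →
            (∀ z → forces x F M z ψ → forces x F M z φ) →
            ∀ w → forces x F M w (md φ) → forces x F M w (md ψ)
  md-cong box    φ ψ φ⊆ψ ψ⊆φ w (w⊩φ , nbhd) =
    φ⊆ψ w w⊩φ , N-ext w _ _ (λ z → mk⇔ (φ⊆ψ z) (ψ⊆φ z)) nbhd
  md-cong dia    φ ψ φ⊆ψ ψ⊆φ w (w⊩φ , ¬nbhd) =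
    φ⊆ψ w w⊩φ , λ nbhd → ¬nbhd (N-ext w _ _ (λ z → mk⇔ (_∘ φ⊆ψ z) (_∘ ψ⊆φ z)) nbhd)
  md-cong bbox   φ ψ φ⊆ψ ψ⊆φ w (w⊩φ , nbhd) =
    φ⊆ψ w w⊩φ , N-ext w _ _ (λ z → mk⇔ (_∘ ψ⊆φ z) (_∘ φ⊆ψ z)) nbhd
  md-cong bullet φ ψ φ⊆ψ ψ⊆φ w (w⊩φ , ¬nbhd) =
    φ⊆ψ w w⊩φ , λ nbhd → ¬nbhd (N-ext w _ _ (λ z → mk⇔ (ψ⊆φ z) (φ⊆ψ z)) nbhd)

module Soundness (x : Mode) (F : Frame) (C : PNCond x F) (M : Model F) where
  open Frame F
  open IsPartialOrder ≤-po using (refl; trans)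

  infix 3 _⊩_
  _⊩_ : W → Fm → Set
  w ⊩ φ = forces x F M w φ

  Valid : Fm → Set
  Valid φ = ∀ w → w ⊩ φ

  ⊩-persistent : ∀ φ {w v} → w ≤ v → w ⊩ φ → v ⊩ φ
  ⊩-persistent (var q) {w} {v} w≤v w⊩q = Model.V-up M q w v w≤v w⊩q
  ⊩-persistent (φ ∧' ψ) w≤v (w⊩φ , w⊩ψ) = ⊩-persistent φ w≤v w⊩φ , ⊩-persistent ψ w≤v w⊩ψ
  ⊩-persistent (φ ∨' ψ) w≤v (inj₁ w⊩φ) = inj₁ (⊩-persistent φ w≤v w⊩φ)
  ⊩-persistent (φ ∨' ψ) w≤v (inj₂ w⊩ψ) = inj₂ (⊩-persistent ψ w≤v w⊩ψ)
  ⊩-persistent (φ ⇒ ψ) w≤v w⊩φ⇒ψ u v≤u = w⊩φ⇒ψ u (trans w≤v v≤u)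
  ⊩-persistent (md φ) w≤v w⊩mdφ =
    md-persistent F M x C φ w≤v (⊩-persistent φ w≤v (md-reflexive F M x φ _ w⊩mdφ)) w⊩mdφ

  valid-⇒-intro : ∀ φ ψ → (∀ z → z ⊩ φ → z ⊩ ψ) → Valid (φ ⇒ ψ)
  valid-⇒-intro φ ψ φ⊆ψ w v _ = φ⊆ψ v

  valid-⇒-elim : ∀ φ ψ → Valid (φ ⇒ ψ) → ∀ z → z ⊩ φ → z ⊩ ψ
  valid-⇒-elim φ ψ ⊨φ⇒ψ z = ⊨φ⇒ψ z z refl

  valid-md-cong : ∀ φ ψ → Valid (φ ⇔' ψ) → Valid (md φ ⇔' md ψ)
  valid-md-cong φ ψ ⊨φ⇔ψ w =
    valid-⇒-intro (md φ) (md ψ) (md-cong F M x φ ψ φ⊆ψ ψ⊆φ) w ,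
    valid-⇒-intro (md ψ) (md φ) (md-cong F M x ψ φ ψ⊆φ φ⊆ψ) w
    where
    φ⊆ψ = valid-⇒-elim φ ψ (proj₁ ∘ ⊨φ⇔ψ)
    ψ⊆φ = valid-⇒-elim ψ φ (proj₂ ∘ ⊨φ⇔ψ)

  sound : ∀ {φ} → Thm x φ → Valid φ
  sound (ax-K φ ψ) w v _ v⊩φ u v≤u _ = ⊩-persistent φ v≤u v⊩φ
  sound (ax-S φ ψ χ) w v _ f u v≤u g t u≤t t⊩φ = f t (trans v≤u u≤t) t⊩φ t refl (g t u≤t t⊩φ)
  sound (ax-∧E₁ φ ψ) w v _ = proj₁
  sound (ax-∧E₂ φ ψ) w v _ = proj₂
  sound (ax-∧I φ ψ) w v _ v⊩φ u v≤u u⊩ψ = ⊩-persistent φ v≤u v⊩φ , u⊩ψ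
  sound (ax-∨I₁ φ ψ) w v _ = inj₁
  sound (ax-∨I₂ φ ψ) w v _ = inj₂
  sound (ax-∨E φ ψ χ) w v _ f u v≤u g t u≤t (inj₁ t⊩φ) = f t (trans v≤u u≤t) t⊩φ
  sound (ax-∨E φ ψ χ) w v _ f u v≤u g t u≤t (inj₂ t⊩ψ) = g t u≤t t⊩ψ
  sound (ax-⊥E φ) w v _ ()
  sound (ax-T φ) = valid-⇒-intro (md φ) φ (md-reflexive F M x φ)
  sound (mp {φ} {ψ} ⊢φ⇒ψ ⊢φ) w = valid-⇒-elim φ ψ (sound ⊢φ⇒ψ) w (sound ⊢φ w)
  sound (cong-md {φ} {ψ} ⊢φ⇔ψ) = valid-md-cong φ ψ (sound ⊢φ⇔ψ)

mainTheorem13 : (x : Mode) (F : Frame) → PNCond x F → (M : Model F) →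
    (φ : Fm) → Thm x φ → (w : Frame.W F) → forces x F M w φ
mainTheorem13 x F C M φ = Soundness.sound x F C M
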